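{- Let $G$ be a transitive permutation group on a finite set $\Omega$, let $g\in G$, let $s(g)$ be the length of a shortest orbit of $\langle g \rangle$ and let $s(G) = \max\{ s(g) : g\in G \}$. Then for any $\omega\in\Omega$, $$\ell(g) \le o(g) \le s(g)\, {\rm meo}(G_\omega) \le \ell(g)\,{\rm meo}(G_\omega),$$ $$\ell(G) \le {\rm meo}(G) \le s(G)\,{\rm meo}(G_\omega) \le \ell(G)\, {\rm meo}(G_\omega).$$
   Context: For a permutation $g$, $o(g)$ is its order and $\ell(g)$ the length of a longest orbit of $\langle g\rangle$. For a permutation group $H$, ${\rm meo}(H)=\max_{h\in H}o(h)$ and $\ell(H)=\max_{h\in H}\ell(h)$. $G_\omega$ is the stabiliser of $\omega$. -}

module Defs where

open import Data.Nat using (ℕ; zero; suc; _≤_)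
open import Data.Fin using (Fin)
open import Data.Fin.Permutation using (Permutation′; _⟨$⟩ʳ_; id; flip; _∘ₚ_; _≈_)
open import Data.Product using (Σ; ∃; _×_)
open import Relation.Binary.PropositionalEquality using (_≡_)

-- Ω = Fin n; Sym(Ω) = Permutation′ n; equality of permutations is pointwise (_≈_).

pow : ∀ {n} → Permutation′ n → ℕ → Fin n → Fin n
pow g zero    x = x
pow g (suc k) x = g ⟨$⟩ʳ pow g k x

record PermGroup (n : ℕ) : Set₁ where
  field
    mem     : Permutation′ n → Set
    mem-≈   : ∀ {g h} → g ≈ h → mem g → mem h
    mem-id  : mem id
    mem-∘   : ∀ {g h} → mem g → mem h → mem (g ∘ₚ h)
    mem-inv : ∀ {g} → mem g → mem (flip g)
open PermGroup public

Transitive : ∀ {n} → PermGroup n → Set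
Transitive {n} G = (x y : Fin n) → Σ (Permutation′ n) λ g → mem G g × g ⟨$⟩ʳ x ≡ y

Stab : ∀ {n} → PermGroup n → Fin n → Permutation′ n → Set
Stab G ω g = mem G g × g ⟨$⟩ʳ ω ≡ ω

IsOrder : ∀ {n} → Permutation′ n → ℕ → Set
IsOrder {n} g k = 1 ≤ k × ((x : Fin n) → pow g k x ≡ x)
  × ((j : ℕ) → 1 ≤ j → ((x : Fin n) → pow g j x ≡ x) → k ≤ j)

IsOrbitLength : ∀ {n} → Permutation′ n → Fin n → ℕ → Set
IsOrbitLength g x k = 1 ≤ k × pow g k x ≡ x × ((j : ℕ) → 1 ≤ j → pow g j x ≡ x → k ≤ j)

IsLongestOrbit : ∀ {n} → Permutation′ n → ℕ → Set
IsLongestOrbit {n} g k = (Σ (Fin n) λ x → IsOrbitLength g x k)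
  × ((x : Fin n) (j : ℕ) → IsOrbitLength g x j → j ≤ k)

IsShortestOrbit : ∀ {n} → Permutation′ n → ℕ → Set
IsShortestOrbit {n} g k = (Σ (Fin n) λ x → IsOrbitLength g x k)
  × ((x : Fin n) (j : ℕ) → IsOrbitLength g x j → k ≤ j)

IsMaxOver : ∀ {n} → (Permutation′ n → Set) → (Permutation′ n → ℕ → Set) → ℕ → Set
IsMaxOver {n} H F m = (Σ (Permutation′ n) λ h → H h × F h m)
  × ((h : Permutation′ n) (k : ℕ) → H h → F h k → k ≤ m)

IsMeo : ∀ {n} → (Permutation′ n → Set) → ℕ → Set
IsMeo H m = IsMaxOver H IsOrder m

IsEllGroup : ∀ {n} → PermGroup n → ℕ → Set
IsEllGroup G m = IsMaxOver (mem G) IsLongestOrbit m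

IsSGroup : ∀ {n} → PermGroup n → ℕ → Set
IsSGroup G m = IsMaxOver (mem G) IsShortestOrbit m

-- A point x on a shortest ⟨g⟩-orbit, of length s, is fixed by gˢ. Conjugating by an element of
-- the transitive group G carrying x to ω turns gˢ into an element of G_ω, of order k ≤ meo(G_ω);
-- then g^(ks) = 1, so o(g) ≤ s(g) meo(G_ω). The other inequalities hold because g^o(g) fixes every
-- point and s(g) ≤ ℓ(g); the group versions follow by applying the element versions to an element
-- realising the relevant maximum.
module Submission where

open import Defs
open import Data.Nat using (ℕ; zero; suc; _+_; _∸_; _*_; _≤_; _<_; _≤?_; >-nonZero; >-nonZero⁻¹)
open import Data.Nat.Properties
  using (≤-trans; ≤-antisym; *-comm; <⇒≤; ≮⇒≥; m<n⇒0<n∸m; m+[n∸m]≡n; n<1+n; *-mono-≤; *-monoˡ-≤; module ≤-Reasoning)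
open import Data.Nat.Divisibility using (_∣_; divides)
open import Data.Nat.Induction using (<-rec)
open import Data.Nat.ListAction using (product)
open import Data.Nat.ListAction.Properties using (∈⇒∣product; product≢0)
open import Data.Fin using (Fin; toℕ; fromℕ<; _≟_)
open import Data.Fin.Properties using (pigeonhole; all?; any?; toℕ<n; toℕ-fromℕ<)
open import Data.Fin.Permutation using (Permutation′; _⟨$⟩ʳ_; _⟨$⟩ˡ_; id; flip; _∘ₚ_; inverseˡ; inverseʳ)
open import Data.List using (map; allFin)
open import Data.List.Extrema.Nat using (argmin; argmax; f[argmin]≤f[xs]; f[xs]≤f[argmax])
open import Data.List.Membership.Propositional.Properties using (∈-map⁺; ∈-allFin)
import Data.List.Relation.Unary.All as All
import Data.List.Relation.Unary.All.Properties as All using (map⁺)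
open import Data.Product using (∃; _×_; _,_; proj₁; proj₂)
open import Function.Bundles using (Injection)
open import Function.Properties.Inverse using (↔⇒↣)
open import Relation.Nullary using (yes; no)
open import Relation.Nullary.Decidable using (_×-dec_)
open import Relation.Unary using (Decidable)
open import Relation.Binary.PropositionalEquality using (_≡_; refl; sym; trans; cong; subst; module ≡-Reasoning)

private
  variable
    n : ℕ

⟨$⟩ʳ-injective : (π : Permutation′ n) {x y : Fin n} → π ⟨$⟩ʳ x ≡ π ⟨$⟩ʳ y → x ≡ y
⟨$⟩ʳ-injective π = Injection.injective (↔⇒↣ π)

pow-+ : (g : Permutation′ n) (a b : ℕ) (x : Fin n) → pow g (a + b) x ≡ pow g a (pow g b x)
pow-+ g zero    b x = refl
pow-+ g (suc a) b x = cong (g ⟨$⟩ʳ_) (pow-+ g a b x)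

pow-injective : (g : Permutation′ n) (k : ℕ) {x y : Fin n} → pow g k x ≡ pow g k y → x ≡ y
pow-injective g zero    eq = eq
pow-injective g (suc k) eq = pow-injective g k (⟨$⟩ʳ-injective g eq)

pow-*-fixed : (g : Permutation′ n) {e : ℕ} {y : Fin n} → pow g e y ≡ y → (q : ℕ) → pow g (q * e) y ≡ y
pow-*-fixed g         gᵉy≡y zero    = refl
pow-*-fixed g {e} {y} gᵉy≡y (suc q) = begin
  pow g (e + q * e) y       ≡⟨ pow-+ g e (q * e) y ⟩
  pow g e (pow g (q * e) y) ≡⟨ cong (pow g e) (pow-*-fixed g gᵉy≡y q) ⟩
  pow g e y                 ≡⟨ gᵉy≡y ⟩
  y                         ∎
  where open ≡-Reasoning

pow-∣-fixed : (g : Permutation′ n) {e k : ℕ} {y : Fin n} → e ∣ k → pow g e y ≡ y → pow g k y ≡ y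
pow-∣-fixed g {y = y} (divides q refl) gᵉy≡y = pow-*-fixed g gᵉy≡y q

-- Pigeonhole on y, g y, …, gⁿ y gives gⁱ y ≡ gʲ y with i < j; cancel gⁱ.
pow-returns : (g : Permutation′ n) (y : Fin n) → ∃ λ e → 1 ≤ e × pow g e y ≡ y
pow-returns {n} g y with pigeonhole (n<1+n n) (λ (i : Fin (suc n)) → pow g (toℕ i) y)
... | i , j , i<j , gⁱy≡gʲy = toℕ j ∸ toℕ i , m<n⇒0<n∸m i<j , pow-injective g (toℕ i) gⁱgᵈy≡gⁱy
  where
  open ≡-Reasoning
  gⁱgᵈy≡gⁱy : pow g (toℕ i) (pow g (toℕ j ∸ toℕ i) y) ≡ pow g (toℕ i) y
  gⁱgᵈy≡gⁱy = begin
    pow g (toℕ i) (pow g (toℕ j ∸ toℕ i) y) ≡⟨ pow-+ g (toℕ i) _ y ⟨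
    pow g (toℕ i + (toℕ j ∸ toℕ i)) y       ≡⟨ cong (λ t → pow g t y) (m+[n∸m]≡n (<⇒≤ i<j)) ⟩
    pow g (toℕ j) y                         ≡⟨ gⁱy≡gʲy ⟨
    pow g (toℕ i) y                         ∎

IsLeastPositive : (ℕ → Set) → ℕ → Set
IsLeastPositive P k = 1 ≤ k × P k × (∀ j → 1 ≤ j → P j → k ≤ j)

leastPositive-unique : {P : ℕ → Set} {a b : ℕ} → IsLeastPositive P a → IsLeastPositive P b → a ≡ b
leastPositive-unique (1≤a , pa , a-least) (1≤b , pb , b-least) = ≤-antisym (a-least _ 1≤b pb) (b-least _ 1≤a pa)

-- The existence lemmas are opaque: only their specifications are used, and unfolding the
-- searches inside them makes unification of later goals very slow.
opaque
  leastPositive-exists : {P : ℕ → Set} → Decidable P → ∀ N → 1 ≤ N → P N → ∃ (IsLeastPositive P)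
  leastPositive-exists {P} P? = <-rec (λ N → 1 ≤ N → P N → ∃ (IsLeastPositive P)) search
    where
    search : ∀ N → (∀ {j} → j < N → 1 ≤ j → P j → ∃ (IsLeastPositive P)) → 1 ≤ N → P N → ∃ (IsLeastPositive P)
    search N below 1≤N pN with any? (λ (i : Fin N) → (1 ≤? toℕ i) ×-dec P? (toℕ i))
    ... | yes (i , 1≤i , pi) = below (toℕ<n i) 1≤i pi
    ... | no none            = N , 1≤N , pN , λ j 1≤j pj → ≮⇒≥ λ j<N →
      none (fromℕ< j<N , subst (λ t → 1 ≤ t × P t) (sym (toℕ-fromℕ< j<N)) (1≤j , pj))

-- A common period of all points: the product of their return times.
order-exists : (g : Permutation′ n) → ∃ (IsOrder g)
order-exists {n} g = leastPositive-exists (λ k → all? (λ x → pow g k x ≟ x)) N 1≤N gᴺ≡id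
  where
  returnTime : Fin n → ℕ
  returnTime y = proj₁ (pow-returns g y)

  N : ℕ
  N = product (map returnTime (allFin n))

  1≤N : 1 ≤ N
  1≤N = >-nonZero⁻¹ N {{product≢0 (All.map⁺ (All.universal (λ y → >-nonZero (proj₁ (proj₂ (pow-returns g y)))) (allFin n)))}}

  gᴺ≡id : ∀ x → pow g N x ≡ x
  gᴺ≡id x = pow-∣-fixed g (∈⇒∣product (∈-map⁺ returnTime (∈-allFin x))) (proj₂ (proj₂ (pow-returns g x)))

orbitLength-exists : (g : Permutation′ n) (x : Fin n) → ∃ (IsOrbitLength g x)
orbitLength-exists g x with pow-returns g x
... | e , 1≤e , gᵉx≡x = leastPositive-exists (λ j → pow g j x ≟ x) e 1≤e gᵉx≡x

orbitLength : Permutation′ n → Fin n → ℕ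
orbitLength g x = proj₁ (orbitLength-exists g x)

opaque
  shortestOrbit-exists : (g : Permutation′ n) → Fin n → ∃ (IsShortestOrbit g)
  shortestOrbit-exists {n} g ω = orbitLength g x , (x , proj₂ (orbitLength-exists g x)) , minimal
    where
    x : Fin n
    x = argmin (orbitLength g) ω (allFin n)

    minimal : ∀ y j → IsOrbitLength g y j → orbitLength g x ≤ j
    minimal y j yj = subst (orbitLength g x ≤_)
      (leastPositive-unique (proj₂ (orbitLength-exists g y)) yj)
      (All.lookup (f[argmin]≤f[xs] ω (allFin n)) (∈-allFin y))

  longestOrbit-exists : (g : Permutation′ n) → Fin n → ∃ (IsLongestOrbit g)
  longestOrbit-exists {n} g ω = orbitLength g x , (x , proj₂ (orbitLength-exists g x)) , maximal
    where
    x : Fin n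
    x = argmax (orbitLength g) ω (allFin n)

    maximal : ∀ y j → IsOrbitLength g y j → j ≤ orbitLength g x
    maximal y j yj = subst (_≤ orbitLength g x)
      (leastPositive-unique (proj₂ (orbitLength-exists g y)) yj)
      (All.lookup (f[xs]≤f[argmax] ω (allFin n)) (∈-allFin y))

_^ₚ_ : Permutation′ n → ℕ → Permutation′ n
g ^ₚ zero  = id
g ^ₚ suc k = (g ^ₚ k) ∘ₚ g

^ₚ-apply : (g : Permutation′ n) (k : ℕ) (y : Fin n) → (g ^ₚ k) ⟨$⟩ʳ y ≡ pow g k y
^ₚ-apply g zero    y = refl
^ₚ-apply g (suc k) y = cong (g ⟨$⟩ʳ_) (^ₚ-apply g k y)

pow-^ₚ : (g : Permutation′ n) (s k : ℕ) (x : Fin n) → pow (g ^ₚ s) k x ≡ pow g (k * s) x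
pow-^ₚ g s zero    x = refl
pow-^ₚ g s (suc k) x = begin
  (g ^ₚ s) ⟨$⟩ʳ pow (g ^ₚ s) k x ≡⟨ ^ₚ-apply g s _ ⟩
  pow g s (pow (g ^ₚ s) k x)     ≡⟨ cong (pow g s) (pow-^ₚ g s k x) ⟩
  pow g s (pow g (k * s) x)      ≡⟨ pow-+ g s (k * s) x ⟨
  pow g (s + k * s) x            ∎
  where open ≡-Reasoning

^ₚ-mem : (G : PermGroup n) {g : Permutation′ n} → mem G g → ∀ k → mem G (g ^ₚ k)
^ₚ-mem G g∈G zero    = mem-id G
^ₚ-mem G g∈G (suc k) = mem-∘ G (^ₚ-mem G g∈G k) g∈G

-- y ↦ h (f (h⁻¹ y)), since _∘ₚ_ composes left to right.
conj : Permutation′ n → Permutation′ n → Permutation′ n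
conj h f = flip h ∘ₚ (f ∘ₚ h)

conj-mem : (G : PermGroup n) {h f : Permutation′ n} → mem G h → mem G f → mem G (conj h f)
conj-mem G h∈G f∈G = mem-∘ G (mem-inv G h∈G) (mem-∘ G f∈G h∈G)

conj-fixes : (h f : Permutation′ n) {x ω : Fin n} → f ⟨$⟩ʳ x ≡ x → h ⟨$⟩ʳ x ≡ ω → conj h f ⟨$⟩ʳ ω ≡ ω
conj-fixes h f {x} {ω} fx≡x hx≡ω = begin
  h ⟨$⟩ʳ (f ⟨$⟩ʳ (h ⟨$⟩ˡ ω))            ≡⟨ cong (λ t → h ⟨$⟩ʳ (f ⟨$⟩ʳ (h ⟨$⟩ˡ t))) hx≡ω ⟨
  h ⟨$⟩ʳ (f ⟨$⟩ʳ (h ⟨$⟩ˡ (h ⟨$⟩ʳ x))) ≡⟨ cong (λ t → h ⟨$⟩ʳ (f ⟨$⟩ʳ t)) (inverseˡ h) ⟩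
  h ⟨$⟩ʳ (f ⟨$⟩ʳ x)                     ≡⟨ cong (h ⟨$⟩ʳ_) fx≡x ⟩
  h ⟨$⟩ʳ x                              ≡⟨ hx≡ω ⟩
  ω                                     ∎
  where open ≡-Reasoning

pow-conj : (h f : Permutation′ n) (k : ℕ) (y : Fin n) → pow (conj h f) k y ≡ h ⟨$⟩ʳ pow f k (h ⟨$⟩ˡ y)
pow-conj h f zero    y = sym (inverseʳ h)
pow-conj h f (suc k) y = cong (λ t → h ⟨$⟩ʳ (f ⟨$⟩ʳ t))
  (trans (cong (h ⟨$⟩ˡ_) (pow-conj h f k y)) (inverseˡ h))

pow-conj-identity : (h f : Permutation′ n) (k : ℕ) → (∀ y → pow (conj h f) k y ≡ y) → ∀ z → pow f k z ≡ z
pow-conj-identity h f k conjᵏ≡id z = ⟨$⟩ʳ-injective h (begin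
  h ⟨$⟩ʳ pow f k z                    ≡⟨ cong (λ t → h ⟨$⟩ʳ pow f k t) (inverseˡ h) ⟨
  h ⟨$⟩ʳ pow f k (h ⟨$⟩ˡ (h ⟨$⟩ʳ z))  ≡⟨ pow-conj h f k (h ⟨$⟩ʳ z) ⟨
  pow (conj h f) k (h ⟨$⟩ʳ z)         ≡⟨ conjᵏ≡id (h ⟨$⟩ʳ z) ⟩
  h ⟨$⟩ʳ z                            ∎)
  where open ≡-Reasoning

order≤returnTime*meo : (G : PermGroup n) → Transitive G → {g : Permutation′ n} → mem G g
  → {ω : Fin n} {m : ℕ} → IsMeo (Stab G ω) m → {o : ℕ} → IsOrder g o
  → {x : Fin n} {s : ℕ} → 1 ≤ s → pow g s x ≡ x → o ≤ s * m
order≤returnTime*meo G tr {g} g∈G {ω} {m} (_ , meo-max) {o} (_ , _ , o-least) {x} {s} 1≤s gˢx≡x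
  with tr x ω
... | h , h∈G , hx≡ω with order-exists (conj h (g ^ₚ s))
...   | k , ord@(1≤k , cᵏ≡id , _) = begin
  o      ≤⟨ o-least (k * s) (*-mono-≤ 1≤k 1≤s) gᵏˢ≡id ⟩
  k * s  ≤⟨ *-monoˡ-≤ s k≤m ⟩
  m * s  ≡⟨ *-comm m s ⟩
  s * m  ∎
  where
  open ≤-Reasoning
  k≤m : k ≤ m
  k≤m = meo-max _ k (conj-mem G h∈G (^ₚ-mem G g∈G s) , conj-fixes h (g ^ₚ s) (trans (^ₚ-apply g s x) gˢx≡x) hx≡ω) ord
  gᵏˢ≡id : ∀ z → pow g (k * s) z ≡ z
  gᵏˢ≡id z = trans (sym (pow-^ₚ g s k z)) (pow-conj-identity h (g ^ₚ s) k cᵏ≡id z)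

longestOrbit≤order : {g : Permutation′ n} {l o : ℕ} → IsLongestOrbit g l → IsOrder g o → l ≤ o
longestOrbit≤order ((x , _ , _ , l-least) , _) (1≤o , gᵒ≡id , _) = l-least _ 1≤o (gᵒ≡id x)

order≤shortestOrbit*meo : (G : PermGroup n) → Transitive G → {g : Permutation′ n} → mem G g
  → {ω : Fin n} {m : ℕ} → IsMeo (Stab G ω) m → {o s : ℕ} → IsOrder g o → IsShortestOrbit g s → o ≤ s * m
order≤shortestOrbit*meo G tr g∈G meo ord ((x , 1≤s , gˢx≡x , _) , _) = order≤returnTime*meo G tr g∈G meo ord 1≤s gˢx≡x

shortestOrbit≤longestOrbit : {g : Permutation′ n} {s l : ℕ} → IsShortestOrbit g s → IsLongestOrbit g l → s ≤ l
shortestOrbit≤longestOrbit (_ , s-min) ((x , xl) , _) = s-min x _ xl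

ellGroup≤meo : (G : PermGroup n) {L M : ℕ} → IsEllGroup G L → IsMeo (mem G) M → L ≤ M
ellGroup≤meo G ((h , h∈G , hL) , _) (_ , M-max) with order-exists h
... | k , ord = ≤-trans (longestOrbit≤order hL ord) (M-max h k h∈G ord)

meo≤sGroup*meo : (G : PermGroup n) → Transitive G → {ω : Fin n} {m : ℕ} → IsMeo (Stab G ω) m
  → {M S : ℕ} → IsMeo (mem G) M → IsSGroup G S → M ≤ S * m
meo≤sGroup*meo G tr {ω} {m} meo ((h , h∈G , hM) , _) (_ , S-max) with shortestOrbit-exists h ω
... | s , hs = ≤-trans (order≤shortestOrbit*meo G tr h∈G meo hM hs) (*-monoˡ-≤ m (S-max h s h∈G hs))

sGroup≤ellGroup : (G : PermGroup n) → Fin n → {S L : ℕ} → IsSGroup G S → IsEllGroup G L → S ≤ L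
sGroup≤ellGroup G ω ((h , h∈G , hS) , _) (_ , L-max) with longestOrbit-exists h ω
... | l , hl = ≤-trans (shortestOrbit≤longestOrbit hS hl) (L-max h l h∈G hl)

lemma2p1 : ∀ {n} (G : PermGroup n) → Transitive G
    → (g : Permutation′ n) → mem G g → (ω : Fin n)
    → (o l s m M L S : ℕ)
    → IsOrder g o → IsLongestOrbit g l → IsShortestOrbit g s
    → IsMeo (Stab G ω) m
    → IsMeo (mem G) M → IsEllGroup G L → IsSGroup G S
    → (l ≤ o × o ≤ s * m × s * m ≤ l * m)
      × (L ≤ M × M ≤ S * m × S * m ≤ L * m)
lemma2p1 G tr g g∈G ω o l s m M L S ord lg sg meo meoG ellG sG =
  ( longestOrbit≤order lg ord
  , order≤shortestOrbit*meo G tr g∈G meo ord sg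
  , *-monoˡ-≤ m (shortestOrbit≤longestOrbit sg lg) )
  , ( ellGroup≤meo G ellG meoG
    , meo≤sGroup*meo G tr meo meoG sG
    , *-monoˡ-≤ m (sGroup≤ellGroup G ω sG ellG) )
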